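{- For $n\ge1$, the number of permutations in $S_n$ equivalent to the identity $\iota_n=12\cdots n$ under adjacent $\{\{123,213\}\}$-equivalence is $\lfloor n/2\rfloor!\,\lceil n/2\rceil!$.
   Context: Permutations are written as words $\pi_1\cdots\pi_n$. A sequence of distinct integers $a_1a_2a_3$ has pattern $\sigma\in S_3$ if $a_s<a_t\iff\sigma_s<\sigma_t$. An adjacent move on $\pi\in S_n$ chooses three consecutive positions $i,i+1,i+2$ with $\pi_i\pi_{i+1}\pi_{i+2}$ of pattern $123$ or $213$ and rearranges these three values in these positions to have the other of these two patterns (i.e., swaps $\pi_i,\pi_{i+1}$ when both are smaller than $\pi_{i+2}$). Equivalence is the equivalence relation generated by such moves. -}

module Defs where

open import Data.Nat using (ℕ; suc; _<_)
open import Data.List using (List; []; _∷_; _++_; map; upTo)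
open import Data.Product using (_×_)
open import Data.List.Relation.Binary.Permutation.Propositional using (_↭_)
open import Relation.Binary.Construct.Closure.Equivalence using (EqClosure)

ι : ℕ → List ℕ
ι n = map suc (upTo n)

IsPerm : ℕ → List ℕ → Set
IsPerm n π = π ↭ ι n

-- One adjacent {123,213}-move: in three consecutive positions with values a b c,
-- where a < c and b < c (so a b c has pattern 123 or 213), swap a and b.
-- (The relation is symmetric, covering both directions 123 → 213 and 213 → 123.)
data Move : List ℕ → List ℕ → Set where
  move : ∀ (xs ys : List ℕ) (a b c : ℕ) → a < c → b < c →
         Move (xs ++ a ∷ b ∷ c ∷ ys) (xs ++ b ∷ a ∷ c ∷ ys)

Equiv : List ℕ → List ℕ → Set
Equiv = EqClosure Move

module Submission where

-- Call a word π = π₁ ⋯ π_n FITTING when 2·π_i ≤ n + i for every position i.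
--   * A move (swap a b in front of c, with a, b < c) preserves fitting in both
--     directions, and ι_n fits; so every word equivalent to ι_n fits.
--   * Conversely, a fitting permutation ρ of 1 ⋯ m followed by the run
--     (m+1) ⋯ (m+k) is equivalent to 1 ⋯ (m+k): the bound guarantees that the
--     letters after the maximum m+1 are no more than k, so m+1 can be bubbled
--     rightwards through them, using the run behind them as the larger third
--     letter that every move needs ("convoy" lemma); then induct on m.
-- Hence, for permutations, "equivalent to ι_n" and "fitting" coincide.
-- The fitting permutations of 1 ⋯ n are enumerated without repetition by
-- inserting m+1 = 1, 2, …, n one after another, each at any index
-- i ≥ 2m+1−n; there are (m+1) ∸ (2m+1 ∸ n) = min(m+1, n−m) such indices, and
-- the product of these numbers is ⌊n/2⌋!·⌈n/2⌉!.

open import Defs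
open import Data.Nat using (ℕ; zero; suc; _+_; _*_; _∸_; _≤_; _<_; z≤n; s≤s; ⌊_/2⌋; ⌈_/2⌉; _!)
open import Data.Nat.Properties
open import Data.Nat.Tactic.RingSolver using (solve-∀)
open import Data.Unit using (⊤; tt)
open import Data.Empty using (⊥-elim)
open import Data.Product using (Σ; _×_; _,_; proj₁; proj₂)
open import Data.List using (List; []; _∷_; _++_; _∷ʳ_; [_]; map; applyUpTo; length; concatMap)
open import Data.List.Properties using (++-assoc; ++-identityʳ; length-++; length-map; map-upTo; ∷-injective; ∷-injectiveʳ)
open import Data.List.Reverse using ([]; _∶_∶ʳ_; reverseView)
open import Data.List.Relation.Unary.All as All using (All; []; _∷_)
open import Data.List.Relation.Unary.All.Properties using (∷ʳ⁻)
open import Data.List.Relation.Unary.Any using (here; there)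
open import Data.List.Relation.Unary.AllPairs.Core using ([]; _∷_)
open import Data.List.Relation.Unary.Unique.Propositional using (Unique)
import Data.List.Relation.Unary.Unique.Propositional.Properties as Unique
open import Data.List.Membership.Propositional using (_∈_; _∉_; find; lose)
open import Data.List.Membership.Propositional.Properties
  using (∈-∃++; ∈-++⁺ˡ; ∈-++⁺ʳ; ∈-map⁺; ∈-map⁻; ∈-concatMap⁺; ∈-concatMap⁻)
open import Data.List.Relation.Binary.Permutation.Propositional using (_↭_; ↭-refl; ↭-sym; ↭-trans; prep)
open import Data.List.Relation.Binary.Permutation.Propositional.Properties
  using (↭-empty-inv; ∈-resp-↭; drop-mid; ↭-length; shift; ∷↭∷ʳ)
open import Function.Bundles using (_⇔_; mk⇔; Equivalence)
open import Relation.Nullary using (¬_)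
open import Relation.Binary.PropositionalEquality hiding ([_])
open import Relation.Binary.Construct.Closure.ReflexiveTransitive using (ε; _◅_)
open import Relation.Binary.Construct.Closure.Symmetric using (fwd; bwd)
import Relation.Binary.Construct.Closure.Equivalence as EqClosure
import Relation.Binary.Reasoning.Setoid as SetoidReasoning

run : ℕ → ℕ → List ℕ
run c zero    = []
run c (suc k) = suc c ∷ run (suc c) k

run-snoc : ∀ c k → run c (suc k) ≡ run c k ∷ʳ suc (c + k)
run-snoc c zero    = cong (λ z → [ suc z ]) (sym (+-identityʳ c))
run-snoc c (suc k) = cong (suc c ∷_) (begin
  run (suc c) (suc k)              ≡⟨ run-snoc (suc c) k ⟩
  run (suc c) k ∷ʳ suc (suc c + k) ≡⟨ cong (λ z → run (suc c) k ∷ʳ suc z) (+-suc c k) ⟨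
  run (suc c) k ∷ʳ suc (c + suc k) ∎)
  where open ≡-Reasoning

length-run : ∀ c k → length (run c k) ≡ k
length-run c zero    = refl
length-run c (suc k) = cong suc (length-run (suc c) k)

run-bound : ∀ c k {v} → v ∈ run c k → v ≤ c + k
run-bound c (suc k) (here refl) = subst (suc c ≤_) (sym (+-suc c k)) (s≤s (m≤m+n c k))
run-bound c (suc k) {v} (there p) = subst (v ≤_) (sym (+-suc c k)) (run-bound (suc c) k p)

applyUpTo-run : ∀ c k (f : ℕ → ℕ) → (∀ i → f i ≡ suc (c + i)) → applyUpTo f k ≡ run c k
applyUpTo-run c zero    f hf = refl
applyUpTo-run c (suc k) f hf = cong₂ _∷_ (trans (hf 0) (cong suc (+-identityʳ c)))
  (applyUpTo-run (suc c) k (λ i → f (suc i)) (λ i → trans (hf (suc i)) (cong suc (+-suc c i))))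

ι-run : ∀ n → ι n ≡ run 0 n
ι-run n = trans (map-upTo suc n) (applyUpTo-run 0 n suc (λ i → refl))

module ≈ = SetoidReasoning (EqClosure.setoid Move)

move-front : ∀ {a b c ys} → a < c → b < c → Equiv (a ∷ b ∷ c ∷ ys) (b ∷ a ∷ c ∷ ys)
move-front {a} {b} {c} {ys} a<c b<c = fwd (move [] ys a b c a<c b<c) ◅ ε

Move-prefix : ∀ p {u v} → Move u v → Move (p ++ u) (p ++ v)
Move-prefix p (move xs ys a b c a<c b<c) =
  subst₂ Move (++-assoc p xs _) (++-assoc p xs _) (move (p ++ xs) ys a b c a<c b<c)

Equiv-prefix : ∀ p {u v} → Equiv u v → Equiv (p ++ u) (p ++ v)
Equiv-prefix p = EqClosure.gmap (p ++_) (Move-prefix p)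

-- Fits B π: the letter at the i-th position of π (counted from 0) satisfies
-- 2·x ≤ B + i.  A word of length n is fitting when Fits (suc n) holds.
Fits : ℕ → List ℕ → Set
Fits B []       = ⊤
Fits B (x ∷ xs) = x + x ≤ B × Fits (suc B) xs

Fits-weaken : ∀ {B} xs → Fits B xs → Fits (suc B) xs
Fits-weaken []       _        = tt
Fits-weaken (x ∷ xs) (hx , h) = m≤n⇒m≤1+n hx , Fits-weaken xs h

Fits-all : ∀ {B xs} → All (λ v → v + v ≤ B) xs → Fits B xs
Fits-all []         = tt
Fits-all (hx ∷ hxs) = hx , Fits-all (All.map m≤n⇒m≤1+n hxs)

Fits-run : ∀ c k {B} → c + c + suc k ≤ B → Fits B (run c k)
Fits-run c zero    _  = tt
Fits-run c (suc k) {B} le =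
  ≤-trans (≤-reflexive (head-eq c)) (≤-trans (+-monoʳ-≤ (c + c) (s≤s (s≤s z≤n))) le) ,
  Fits-run (suc c) k (subst (_≤ suc B) (sym (tail-eq c k)) (s≤s le))
  where
  head-eq : ∀ c → suc c + suc c ≡ c + c + 2
  head-eq = solve-∀
  tail-eq : ∀ c k → suc c + suc c + suc k ≡ suc (c + c + suc (suc k))
  tail-eq = solve-∀

Fits-at : ∀ a {x b B} → Fits B (a ++ x ∷ b) → x + x ≤ length a + B
Fits-at []                  (hx , _) = hx
Fits-at (y ∷ a) {x} {B = B} (_ , h)  = subst (x + x ≤_) (+-suc (length a) B) (Fits-at a h)

Fits-insert : ∀ a {x b B} → Fits B (a ++ b) → x + x ≤ length a + B → Fits B (a ++ x ∷ b)
Fits-insert []      {b = b}     h        hx = hx , Fits-weaken b h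
Fits-insert (y ∷ a) {x} {B = B} (hy , h) hx =
  hy , Fits-insert a h (subst (x + x ≤_) (sym (+-suc (length a) B)) hx)

Fits-remove : ∀ a {x b B} → Fits B (a ++ x ∷ b) → All (λ v → v + v ≤ length a + B) b → Fits B (a ++ b)
Fits-remove []      (_ , _) hb = Fits-all hb
Fits-remove (y ∷ a) {B = B} (hy , h) hb =
  hy , Fits-remove a h (All.map (λ {v} → subst (v + v ≤_) (sym (+-suc (length a) B))) hb)

-- A letter that dominates everything after it can be removed: the letters
-- after it move one step left but were no larger than it.
Fits-remove-dominant : ∀ a {x b B} → All (_≤ x) b → Fits B (a ++ x ∷ b) → Fits B (a ++ b)
Fits-remove-dominant a b≤x h =
  Fits-remove a h (All.map (λ v≤x → ≤-trans (+-mono-≤ v≤x v≤x) (Fits-at a h)) b≤x)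

-- The swapped letter b ends up one position earlier, which it can afford
-- because b < c and c fitted two positions later.
Fits-move : ∀ xs {ys a b c B} → a < c → b < c → Fits B (xs ++ a ∷ b ∷ c ∷ ys) → Fits B (xs ++ b ∷ a ∷ c ∷ ys)
Fits-move [] {b = b} {B = B} a<c b<c (ha , hb , hc , h) = earlier , m≤n⇒m≤1+n ha , hc , h
  where
  earlier : b + b ≤ B
  earlier = ≤-pred (≤-pred (subst (_≤ suc (suc B)) (cong suc (+-suc b b)) (≤-trans (+-mono-≤ b<c b<c) hc)))
Fits-move (x ∷ xs) a<c b<c (hx , h) = hx , Fits-move xs a<c b<c h

Fits-equiv : ∀ {B u v} → Equiv u v → Fits B v → Fits B u
Fits-equiv ε h = h
Fits-equiv (fwd (move xs _ _ _ _ a<c b<c) ◅ e) h = Fits-move xs b<c a<c (Fits-equiv e h)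
Fits-equiv (bwd (move xs _ _ _ _ a<c b<c) ◅ e) h = Fits-move xs a<c b<c (Fits-equiv e h)

-- A letter g ≤ c passes rightwards through the run (c+1)⋯(c+j), each swap
-- enabled by the next letter of the run or by a final letter t > c + j.
push : ∀ j c {g t rest} → g ≤ c → c + j < t →
  Equiv (g ∷ run c j ++ t ∷ rest) (run c j ++ g ∷ t ∷ rest)
push zero          c             _   _  = ε
push (suc zero)    c {g} {t}     g≤c lt = move-front (≤-<-trans g≤c (<-trans (n<1+n c) lt′)) lt′
  where
  lt′ : suc c < t
  lt′ = subst (_< t) (+-comm c 1) lt
push (suc (suc j)) c {t = t} g≤c lt = EqClosure.transitive Move
  (move-front (s≤s (m≤n⇒m≤1+n g≤c)) (n<1+n (suc c)))
  (Equiv-prefix [ suc c ] (push (suc j) (suc c) (m≤n⇒m≤1+n g≤c) (subst (_< t) (+-suc c (suc j)) lt)))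

snoc-layout : ∀ γ g c k rest → (γ ∷ʳ g) ++ run c (suc k) ++ rest ≡ γ ++ g ∷ run c k ++ suc (c + k) ∷ rest
snoc-layout γ g c k rest = begin
  (γ ∷ʳ g) ++ run c (suc k) ++ rest           ≡⟨ ++-assoc γ [ g ] _ ⟩
  γ ++ g ∷ run c (suc k) ++ rest              ≡⟨ cong (λ z → γ ++ g ∷ z ++ rest) (run-snoc c k) ⟩
  γ ++ g ∷ (run c k ∷ʳ suc (c + k)) ++ rest   ≡⟨ cong (λ z → γ ++ g ∷ z) (++-assoc (run c k) _ rest) ⟩
  γ ++ g ∷ run c k ++ suc (c + k) ∷ rest      ∎
  where open ≡-Reasoning

-- The last letter of γ is pushed past all but the last letter of the run,
-- which reduces to a shorter γ and run; the push is undone afterwards.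
convoy : ∀ k c {a b rest} γ → a ≤ c → b ≤ c → All (_≤ c) γ → length γ < k →
  Equiv (a ∷ b ∷ γ ++ run c k ++ rest) (b ∷ a ∷ γ ++ run c k ++ rest)
convoy (suc k) c γ a≤c b≤c γ≤c len with reverseView γ
... | [] = move-front (s≤s a≤c) (s≤s b≤c)
convoy (suc k) c {a} {b} {rest} γ a≤c b≤c γ≤c len | γ′ ∶ _ ∶ʳ g = begin
  a ∷ b ∷ (γ′ ∷ʳ g) ++ run c (suc k) ++ rest  ≡⟨ cong (λ z → a ∷ b ∷ z) (snoc-layout γ′ g c k rest) ⟩
  a ∷ b ∷ γ′ ++ g ∷ run c k ++ t ∷ rest        ≈⟨ Equiv-prefix (a ∷ b ∷ γ′) pushed ⟩
  a ∷ b ∷ γ′ ++ run c k ++ g ∷ t ∷ rest        ≈⟨ convoy k c γ′ a≤c b≤c (proj₁ (∷ʳ⁻ γ≤c)) len′ ⟩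
  b ∷ a ∷ γ′ ++ run c k ++ g ∷ t ∷ rest        ≈⟨ Equiv-prefix (b ∷ a ∷ γ′) pushed ⟨
  b ∷ a ∷ γ′ ++ g ∷ run c k ++ t ∷ rest        ≡⟨ cong (λ z → b ∷ a ∷ z) (snoc-layout γ′ g c k rest) ⟨
  b ∷ a ∷ (γ′ ∷ʳ g) ++ run c (suc k) ++ rest  ∎
  where
  open ≈
  t = suc (c + k)
  pushed : Equiv (g ∷ run c k ++ t ∷ rest) (run c k ++ g ∷ t ∷ rest)
  pushed = push k c (proj₂ (∷ʳ⁻ γ≤c)) (n<1+n (c + k))
  len′ : length γ′ < k
  len′ = subst (_≤ k) (+-comm (length γ′) 1) (≤-pred (subst (λ z → suc z ≤ suc k) (length-++ γ′) len))

bubble : ∀ k c {x rest} b → x ≤ c → All (_≤ c) b → length b ≤ k →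
  Equiv (x ∷ b ++ run c k ++ rest) (b ++ x ∷ run c k ++ rest)
bubble k c             []      _   _           _   = ε
bubble k c {x} {rest} (y ∷ b) x≤c (y≤c ∷ b≤c) len = begin
  x ∷ y ∷ b ++ run c k ++ rest  ≈⟨ convoy k c b x≤c y≤c b≤c len ⟩
  y ∷ x ∷ b ++ run c k ++ rest  ≈⟨ Equiv-prefix [ y ] (bubble k c b x≤c b≤c (<⇒≤ len)) ⟩
  y ∷ b ++ x ∷ run c k ++ rest  ∎
  where open ≈

record MaxSplit (m : ℕ) (ρ : List ℕ) : Set where
  field
    before after : List ℕ
    split        : ρ ≡ before ++ suc m ∷ after
    rest-perm    : before ++ after ↭ run 0 m
    after-small  : All (_≤ suc m) after

maxSplit : ∀ m {ρ} → ρ ↭ run 0 (suc m) → MaxSplit m ρ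
maxSplit m p with ∈-∃++ (∈-resp-↭ (↭-sym p) max∈)
  where
  max∈ : suc m ∈ run 0 (suc m)
  max∈ = subst (suc m ∈_) (sym (run-snoc 0 m)) (∈-++⁺ʳ (run 0 m) (here refl))
... | a , b , refl = record
  { before = a ; after = b ; split = refl ; rest-perm = rest-perm
  ; after-small = All.tabulate (λ v∈b → m≤n⇒m≤1+n (run-bound 0 m (∈-resp-↭ rest-perm (∈-++⁺ʳ a v∈b)))) }
  where
  rest-perm : a ++ b ↭ run 0 m
  rest-perm = subst (a ++ b ↭_) (++-identityʳ (run 0 m))
    (drop-mid a (run 0 m) (subst (a ++ suc m ∷ b ↭_) (run-snoc 0 m) p))

-- The fitting bound on the maximum leaves it at most k letters to overtake.
room : ∀ i j k → suc (i + j) + suc (i + j) ≤ i + suc (suc (i + j) + k) → j ≤ k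
room i j k le = +-cancelˡ-≤ i j k (≤-pred (+-cancelˡ-≤ (suc (i + j)) _ _ (subst (suc (i + j) + suc (i + j) ≤_) (rearrange i j k) le)))
  where
  rearrange : ∀ i j k → i + suc (suc (i + j) + k) ≡ suc (i + j) + suc (i + k)
  rearrange = solve-∀

-- A fitting permutation ρ of 1 ⋯ m followed by (m+1) ⋯ (m+k) is equivalent
-- to 1 ⋯ (m+k): bubble the maximum of ρ into the run, then induct.
reach : ∀ m k {ρ} → ρ ↭ run 0 m → Fits (suc (m + k)) ρ → Equiv (ρ ++ run m k) (run 0 (m + k))
reach zero    k p _ with ↭-empty-inv p
... | refl = ε
reach (suc m) k p fits with maxSplit m p
... | record { before = a ; after = b ; split = refl ; rest-perm = rest ; after-small = small } = begin
  (a ++ suc m ∷ b) ++ run (suc m) k      ≡⟨ ++-assoc a (suc m ∷ b) _ ⟩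
  a ++ suc m ∷ b ++ run (suc m) k        ≡⟨ cong (λ z → a ++ suc m ∷ b ++ z) (++-identityʳ _) ⟨
  a ++ suc m ∷ b ++ run (suc m) k ++ []  ≈⟨ Equiv-prefix a (bubble k (suc m) b ≤-refl small short) ⟩
  a ++ b ++ suc m ∷ run (suc m) k ++ []  ≡⟨ cong (λ z → a ++ b ++ suc m ∷ z) (++-identityʳ _) ⟩
  a ++ b ++ run m (suc k)                ≡⟨ ++-assoc a b _ ⟨
  (a ++ b) ++ run m (suc k)              ≈⟨ reach m (suc k) rest fits′ ⟩
  run 0 (m + suc k)                      ≡⟨ cong (run 0) (+-suc m k) ⟩
  run 0 (suc m + k)                      ∎
  where
  open ≈
  lengths : length a + length b ≡ m
  lengths = trans (sym (length-++ a)) (trans (↭-length rest) (length-run 0 m))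
  short : length b ≤ k
  short with lengths
  ... | refl = room (length a) (length b) k (Fits-at a fits)
  fits′ : Fits (suc (m + suc k)) (a ++ b)
  fits′ = subst (λ z → Fits (suc z) (a ++ b)) (sym (+-suc m k)) (Fits-remove-dominant a small fits)

characterisation : ∀ n {π} → π ↭ run 0 n → Equiv π (run 0 n) ⇔ Fits (suc n) π
characterisation n {π} p = mk⇔ necessary sufficient
  where
  necessary : Equiv π (run 0 n) → Fits (suc n) π
  necessary e = Fits-equiv e (Fits-run 0 n ≤-refl)
  sufficient : Fits (suc n) π → Equiv π (run 0 n)
  sufficient fits = subst₂ Equiv (++-identityʳ π) (cong (run 0) (+-identityʳ n))
    (reach n 0 p (subst (λ z → Fits (suc z) π) (sym (+-identityʳ n)) fits))

-- insertions k x ρ: the words obtained by inserting x into ρ after at least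
-- k letters, each listed once.
insertions : ℕ → ℕ → List ℕ → List (List ℕ)
insertions zero    x []       = [ [ x ] ]
insertions zero    x (y ∷ ys) = (x ∷ y ∷ ys) ∷ map (y ∷_) (insertions zero x ys)
insertions (suc k) x []       = []
insertions (suc k) x (y ∷ ys) = map (y ∷_) (insertions k x ys)

record Insertion (k x : ℕ) (ρ ω : List ℕ) : Set where
  field
    before after : List ℕ
    source       : ρ ≡ before ++ after
    target       : ω ≡ before ++ x ∷ after
    late         : k ≤ length before

insertion-cons : ∀ {k x ρ ω} y → Insertion k x ρ ω → Insertion (suc k) x (y ∷ ρ) (y ∷ ω)
insertion-cons y i = record
  { before = y ∷ before ; after = after ; source = cong (y ∷_) source ; target = cong (y ∷_) target ; late = s≤s late }
  where open Insertion i

insertion-weaken : ∀ {k x ρ ω} → Insertion (suc k) x ρ ω → Insertion k x ρ ω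
insertion-weaken i = record
  { before = before ; after = after ; source = source ; target = target ; late = ≤-trans (n≤1+n _) late }
  where open Insertion i

insertions-sound : ∀ k x ρ {ω} → ω ∈ insertions k x ρ → Insertion k x ρ ω
insertions-sound zero x [] (here refl) =
  record { before = [] ; after = [] ; source = refl ; target = refl ; late = z≤n }
insertions-sound zero x (y ∷ ys) (here refl) =
  record { before = [] ; after = y ∷ ys ; source = refl ; target = refl ; late = z≤n }
insertions-sound zero x (y ∷ ys) (there p) with ∈-map⁻ (y ∷_) p
... | _ , p′ , refl = insertion-weaken (insertion-cons y (insertions-sound zero x ys p′))
insertions-sound (suc k) x (y ∷ ys) p with ∈-map⁻ (y ∷_) p
... | _ , p′ , refl = insertion-cons y (insertions-sound k x ys p′)

insertions-complete : ∀ k x a b → k ≤ length a → a ++ x ∷ b ∈ insertions k x (a ++ b)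
insertions-complete zero    x []      []      _         = here refl
insertions-complete zero    x []      (y ∷ b) _         = here refl
insertions-complete zero    x (y ∷ a) b       _         = there (∈-map⁺ (y ∷_) (insertions-complete zero x a b z≤n))
insertions-complete (suc k) x (y ∷ a) b       (s≤s k≤a) = ∈-map⁺ (y ∷_) (insertions-complete k x a b k≤a)

insertions-length : ∀ k x ρ → length (insertions k x ρ) ≡ suc (length ρ) ∸ k
insertions-length zero    x []       = refl
insertions-length zero    x (y ∷ ys) =
  cong suc (trans (length-map (y ∷_) (insertions zero x ys)) (insertions-length zero x ys))
insertions-length (suc k) x []       = sym (0∸n≡0 k)
insertions-length (suc k) x (y ∷ ys) = trans (length-map (y ∷_) (insertions k x ys)) (insertions-length k x ys)

insertions-unique : ∀ k x ρ → x ∉ ρ → Unique (insertions k x ρ)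
insertions-unique zero    x []       _  = [] ∷ []
insertions-unique zero    x (y ∷ ys) x∉ =
  All.tabulate head-new ∷ Unique.map⁺ ∷-injectiveʳ (insertions-unique zero x ys (λ p → x∉ (there p)))
  where
  head-new : ∀ {ω} → ω ∈ map (y ∷_) (insertions zero x ys) → x ∷ y ∷ ys ≢ ω
  head-new p eq with ∈-map⁻ (y ∷_) p
  head-new p refl | _ , _ , refl = x∉ (here refl)
insertions-unique (suc k) x []       _  = []
insertions-unique (suc k) x (y ∷ ys) x∉ = Unique.map⁺ ∷-injectiveʳ (insertions-unique k x ys (λ p → x∉ (there p)))

split-unique : ∀ {x} a₁ a₂ {b₁ b₂ : List ℕ} → x ∉ a₁ → x ∉ a₂ →
  a₁ ++ x ∷ b₁ ≡ a₂ ++ x ∷ b₂ → a₁ ≡ a₂ × b₁ ≡ b₂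
split-unique []       []       _  _  refl = refl , refl
split-unique []       (_ ∷ _)  _  x∉ refl = ⊥-elim (x∉ (here refl))
split-unique (_ ∷ _)  []       x∉ _  refl = ⊥-elim (x∉ (here refl))
split-unique (y ∷ a₁) (z ∷ a₂) x∉₁ x∉₂ eq with ∷-injective eq
... | refl , eq′ with split-unique a₁ a₂ (λ p → x∉₁ (there p)) (λ p → x∉₂ (there p)) eq′
... | refl , refl = refl , refl

insertion-source-unique : ∀ {k x ρ₁ ρ₂ ω} → x ∉ ρ₁ → x ∉ ρ₂ →
  Insertion k x ρ₁ ω → Insertion k x ρ₂ ω → ρ₁ ≡ ρ₂
insertion-source-unique x∉₁ x∉₂
  record { before = a₁ ; after = b₁ ; source = refl ; target = refl }
  record { before = a₂ ; after = b₂ ; source = refl ; target = eq }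
  with split-unique a₁ a₂ (λ p → x∉₁ (∈-++⁺ˡ p)) (λ p → x∉₂ (∈-++⁺ˡ p)) eq
... | refl , refl = refl

concatMap-unique : ∀ {A B : Set} (f : A → List B) xs → Unique xs → (∀ {x} → x ∈ xs → Unique (f x)) →
  (∀ {x₁ x₂ y} → x₁ ∈ xs → x₂ ∈ xs → y ∈ f x₁ → y ∈ f x₂ → x₁ ≡ x₂) → Unique (concatMap f xs)
concatMap-unique f []       _          _       _        = []
concatMap-unique f (x ∷ xs) (x∉ ∷ u) unique disjoint =
  Unique.++⁺ (unique (here refl))
    (concatMap-unique f xs u (λ p → unique (there p)) (λ p q → disjoint (there p) (there q)))
    apart
  where
  apart : ∀ {y} → ¬ (y ∈ f x × y ∈ concatMap f xs)
  apart (p , q) with find (∈-concatMap⁻ f {xs = xs} q)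
  ... | x′ , x′∈ , q′ = All.lookup x∉ x′∈ (disjoint (here refl) (there x′∈) p q′)

concatMap-length : ∀ {A B : Set} (f : A → List B) xs c → (∀ {x} → x ∈ xs → length (f x) ≡ c) →
  length (concatMap f xs) ≡ length xs * c
concatMap-length f []       c _  = refl
concatMap-length f (x ∷ xs) c hf =
  trans (length-++ (f x)) (cong₂ _+_ (hf (here refl)) (concatMap-length f xs c (λ p → hf (there p))))

module Enumeration (N : ℕ) where

  -- first m: the least index at which m+1 may be inserted into a word of
  -- length m while keeping the bound for length N.
  first : ℕ → ℕ
  first m = (m + suc m) ∸ N

  first-sound : ∀ m i → first m ≤ i → suc m + suc m ≤ i + suc N
  first-sound m i le = begin
    suc (m + suc m)   ≤⟨ s≤s (m≤n+m∸n (m + suc m) N) ⟩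
    suc (N + first m) ≤⟨ s≤s (+-monoʳ-≤ N le) ⟩
    suc (N + i)       ≡⟨ cong suc (+-comm N i) ⟩
    suc (i + N)       ≡⟨ +-suc i N ⟨
    i + suc N         ∎
    where open ≤-Reasoning

  first-complete : ∀ m i → suc m + suc m ≤ i + suc N → first m ≤ i
  first-complete m i le = m≤n+o⇒m∸n≤o (m + suc m) N
    (subst (m + suc m ≤_) (+-comm i N) (≤-pred (subst (suc m + suc m ≤_) (+-suc i N) le)))

  perms : ℕ → List (List ℕ)
  perms zero    = [ [] ]
  perms (suc m) = concatMap (insertions (first m) (suc m)) (perms m)

  insert-max : ∀ m a b → a ++ b ↭ run 0 m → a ++ suc m ∷ b ↭ run 0 (suc m)
  insert-max m a b p = ↭-trans (shift (suc m) a b) (↭-trans (prep (suc m) p)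
    (subst (suc m ∷ run 0 m ↭_) (sym (run-snoc 0 m)) (∷↭∷ʳ (suc m) (run 0 m))))

  perms-sound : ∀ m {ω} → ω ∈ perms m → ω ↭ run 0 m × Fits (suc N) ω
  perms-sound zero    (here refl) = ↭-refl , tt
  perms-sound (suc m) q with find (∈-concatMap⁻ (insertions (first m) (suc m)) {xs = perms m} q)
  ... | ρ , ρ∈ , ω∈ with perms-sound m ρ∈ | insertions-sound (first m) (suc m) ρ ω∈
  ... | perm , fits | record { before = a ; after = b ; source = refl ; target = refl ; late = late } =
    insert-max m a b perm , Fits-insert a fits (first-sound m (length a) late)

  perms-complete : ∀ m {ω} → ω ↭ run 0 m → Fits (suc N) ω → ω ∈ perms m
  perms-complete zero    p _ with ↭-empty-inv p
  ... | refl = here refl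
  perms-complete (suc m) p fits with maxSplit m p
  ... | record { before = a ; after = b ; split = refl ; rest-perm = rest ; after-small = small } =
    ∈-concatMap⁺ (insertions (first m) (suc m)) {xs = perms m}
      (lose (perms-complete m rest (Fits-remove-dominant a small fits))
            (insertions-complete (first m) (suc m) a b (first-complete m (length a) (Fits-at a fits))))

  -- Different words of perms m never contain m+1, so insertions of it can be told apart.
  max-new : ∀ m {ρ} → ρ ∈ perms m → suc m ∉ ρ
  max-new m ρ∈ m+1∈ = 1+n≰n (run-bound 0 m (∈-resp-↭ (proj₁ (perms-sound m ρ∈)) m+1∈))

  perms-unique : ∀ m → Unique (perms m)
  perms-unique zero    = [] ∷ []
  perms-unique (suc m) = concatMap-unique (insertions (first m) (suc m)) (perms m) (perms-unique m)
    (λ {ρ} ρ∈ → insertions-unique (first m) (suc m) ρ (max-new m ρ∈))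
    (λ {ρ₁} {ρ₂} ρ₁∈ ρ₂∈ p₁ p₂ → insertion-source-unique (max-new m ρ₁∈) (max-new m ρ₂∈)
       (insertions-sound (first m) (suc m) ρ₁ p₁) (insertions-sound (first m) (suc m) ρ₂ p₂))

  choices : ℕ → ℕ
  choices m = suc m ∸ first m

  count : ℕ → ℕ
  count zero    = 1
  count (suc m) = count m * choices m

  perms-length : ∀ m → length (perms m) ≡ count m
  perms-length zero    = refl
  perms-length (suc m) =
    trans (concatMap-length (insertions (first m) (suc m)) (perms m) (choices m) each)
          (cong (_* choices m) (perms-length m))
    where
    each : ∀ {ρ} → ρ ∈ perms m → length (insertions (first m) (suc m) ρ) ≡ choices m
    each {ρ} ρ∈ = trans (insertions-length (first m) (suc m) ρ)
      (cong (λ z → suc z ∸ first m) (trans (↭-length (proj₁ (perms-sound m ρ∈))) (length-run 0 m)))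

  choices-low : ∀ m → m + suc m ≤ N → choices m ≡ suc m
  choices-low m le = cong (suc m ∸_) (m≤n⇒m∸n≡0 le)

  choices-high : ∀ m → m ≤ N → N ≤ m + suc m → choices m ≡ N ∸ m
  choices-high m m≤N N≤ = begin
    suc m ∸ first m      ≡⟨ cong (_∸ first m) r+d≡1+m ⟨
    r + first m ∸ first m ≡⟨ m+n∸n≡m r (first m) ⟩
    r                    ∎
    where
    open ≡-Reasoning
    r = N ∸ m
    r+d≡1+m : r + first m ≡ suc m
    r+d≡1+m = +-cancelˡ-≡ m _ _ (begin
      m + (r + first m) ≡⟨ +-assoc m r (first m) ⟨
      m + r + first m   ≡⟨ cong (_+ first m) (m+[n∸m]≡n m≤N) ⟩
      N + first m       ≡⟨ m+[n∸m]≡n N≤ ⟩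
      m + suc m         ∎)

⌈n/2⌉≤1+⌊n/2⌋ : ∀ n → ⌈ n /2⌉ ≤ suc ⌊ n /2⌋
⌈n/2⌉≤1+⌊n/2⌋ zero          = z≤n
⌈n/2⌉≤1+⌊n/2⌋ (suc zero)    = s≤s z≤n
⌈n/2⌉≤1+⌊n/2⌋ (suc (suc n)) = s≤s (⌈n/2⌉≤1+⌊n/2⌋ n)

n≤⌈n/2⌉+⌈n/2⌉ : ∀ n → n ≤ ⌈ n /2⌉ + ⌈ n /2⌉
n≤⌈n/2⌉+⌈n/2⌉ n = subst (_≤ ⌈ n /2⌉ + ⌈ n /2⌉) (⌊n/2⌋+⌈n/2⌉≡n n) (+-monoˡ-≤ ⌈ n /2⌉ (⌊n/2⌋≤⌈n/2⌉ n))

module Counting (N : ℕ) where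
  open Enumeration N

  f c : ℕ
  f = ⌊ N /2⌋
  c = ⌈ N /2⌉

  N≡c+f : N ≡ c + f
  N≡c+f = trans (sym (⌊n/2⌋+⌈n/2⌉≡n N)) (+-comm f c)

  count-low : ∀ m → m ≤ c → count m ≡ m !
  count-low zero    _  = refl
  count-low (suc m) le = begin
    count m * choices m ≡⟨ cong₂ _*_ (count-low m (<⇒≤ le)) (choices-low m lower) ⟩
    m ! * suc m         ≡⟨ *-comm (m !) (suc m) ⟩
    suc m !             ∎
    where
    open ≡-Reasoning
    lower : m + suc m ≤ N
    lower = subst (m + suc m ≤_) (⌊n/2⌋+⌈n/2⌉≡n N) (+-mono-≤ (≤-pred (≤-trans le (⌈n/2⌉≤1+⌊n/2⌋ N))) le)

  choices-upper : ∀ j k → suc j + k ≡ f → choices (c + j) ≡ suc k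
  choices-upper j k eq = begin
    choices (c + j)     ≡⟨ choices-high (c + j) (<⇒≤ below) above ⟩
    N ∸ (c + j)         ≡⟨ cong (_∸ (c + j)) N≡c+f ⟩
    (c + f) ∸ (c + j)   ≡⟨ [m+n]∸[m+o]≡n∸o c f j ⟩
    f ∸ j               ≡⟨ cong (_∸ j) (trans (sym eq) (sym (+-suc j k))) ⟩
    (j + suc k) ∸ j     ≡⟨ m+n∸m≡n j (suc k) ⟩
    suc k               ∎
    where
    open ≡-Reasoning
    below : c + j < N
    below = subst (c + j <_) (sym N≡c+f) (+-monoʳ-< c (subst (j <_) eq (s≤s (m≤m+n j k))))
    above : N ≤ (c + j) + suc (c + j)
    above = ≤-trans (n≤⌈n/2⌉+⌈n/2⌉ N) (+-mono-≤ (m≤m+n c j) (m≤n⇒m≤1+n (m≤m+n c j)))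

  count-high : ∀ j k → j + k ≡ f → count (c + j) * k ! ≡ c ! * f !
  count-high zero    k refl = cong₂ _*_ (trans (cong count (+-identityʳ c)) (count-low c ≤-refl)) refl
  count-high (suc j) k eq   = begin
    count (c + suc j) * k !            ≡⟨ cong (λ z → count z * k !) (+-suc c j) ⟩
    count (c + j) * choices (c + j) * k ! ≡⟨ cong (λ z → count (c + j) * z * k !) (choices-upper j k eq) ⟩
    count (c + j) * suc k * k !        ≡⟨ *-assoc (count (c + j)) (suc k) (k !) ⟩
    count (c + j) * suc k !            ≡⟨ count-high j (suc k) (trans (+-suc j k) eq) ⟩
    c ! * f !                          ∎
    where open ≡-Reasoning

  count-total : count N ≡ f ! * c !
  count-total = begin
    count N             ≡⟨ cong count N≡c+f ⟩
    count (c + f)       ≡⟨ *-identityʳ _ ⟨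
    count (c + f) * 0 ! ≡⟨ count-high f 0 (+-identityʳ f) ⟩
    c ! * f !           ≡⟨ *-comm (c !) (f !) ⟩
    f ! * c !           ∎
    where open ≡-Reasoning

theorem3p1 : ∀ (n : ℕ) → 1 ≤ n →
    Σ (List (List ℕ)) λ L →
      Unique L
      × (∀ (π : List ℕ) → (π ∈ L) ⇔ (IsPerm n π × Equiv π (ι n)))
      × length L ≡ (⌊ n /2⌋ !) * (⌈ n /2⌉ !)
theorem3p1 n _ = perms n , perms-unique n , membership , trans (perms-length n) count-total
  where
  open Enumeration n
  open Counting n

  described : ∀ π → π ∈ perms n ⇔ (π ↭ run 0 n × Equiv π (run 0 n))
  described π = mk⇔
    (λ π∈ → let (perm , fits) = perms-sound n π∈ in perm , Equivalence.from (characterisation n perm) fits)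
    (λ (perm , e) → perms-complete n perm (Equivalence.to (characterisation n perm) e))

  membership : ∀ π → π ∈ perms n ⇔ (IsPerm n π × Equiv π (ι n))
  membership π = subst (λ w → π ∈ perms n ⇔ (π ↭ w × Equiv π w)) (sym (ι-run n)) (described π)
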